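{- Let $G$ be a finite group and suppose $X_G$ contains an induced subhypergraph isomorphic (respecting the ordering of the three parts) to the vertex-disjoint union of hypergraphs $M_{n_i,m_i,p_i}$, $i=1,\dots,k$. Then $\mathrm{val}(G)\ge\sum_i n_im_ip_i$.
   Context: $X_G$ is the tripartite 3-uniform hypergraph with ordered parts $X_1=X_2=X_3=G$, where $(g_1,g_2,g_3)$ is a hyperedge iff $g_1g_2g_3=1$. $M_{p,q,r}$ has parts $[p]\times[q]$, $[q]\times[r]$, $[r]\times[p]$, with $((i,j),(k,l),(m,n))$ a hyperedge iff $j=k,l=m,n=i$. A triple $(A,B,C)$ of subsets of $G$ is equilateral trapezoid-free if for every fixed $a'\in A,b'\in B,c'\in C$, each of the following systems has at most one solution $(a,b,c)\in A\times B\times C$: $1=a'bc=ab'c$; $1=a'bc=abc'$; $1=ab'c=abc'$. $\mathrm{val}(G)$ is the maximum, over equilateral trapezoid-free triples $(A,B,C)$, of the number of $(a,b,c)\in A\times B\times C$ with $abc=1$. -}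

module Defs where

open import Level using (Level; 0ℓ) renaming (suc to lsuc)
open import Data.Nat using (ℕ; _+_; _*_; _≤_)
open import Data.Fin using (Fin)
open import Data.Fin.Properties using (_≟_)
open import Data.Fin.Subset using (Subset; _∈_)
open import Data.Fin.Subset.Properties using (_∈?_)
open import Data.List using (List; allFin; map)
open import Data.Nat.ListAction using (sum)
open import Data.Product using (Σ; Σ-syntax; ∃-syntax; _×_; _,_)
open import Data.Bool using (Bool; true; false; if_then_else_)
open import Relation.Nullary using (does)
open import Relation.Binary.PropositionalEquality using (_≡_)
open import Algebra.Core using (Op₁; Op₂)
open import Algebra.Structures using (IsGroup)
open import Function using (_⇔_)
open import Function.Definitions using (Injective)

-- Finite groups: a group structure on Fin n (every finite group is
-- isomorphic to one of these), with propositional equality.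

record FinGroup (n : ℕ) : Set where
  field
    _∙_     : Op₂ (Fin n)
    ε       : Fin n
    _⁻¹     : Op₁ (Fin n)
    isGroup : IsGroup _≡_ _∙_ ε _⁻¹

record Hypergraph3 : Set₁ where
  field
    V₁ V₂ V₃ : Set
    E        : V₁ → V₂ → V₃ → Set

open Hypergraph3

X : {n : ℕ} → FinGroup n → Hypergraph3
X {n} G = record
  { V₁ = Fin n ; V₂ = Fin n ; V₃ = Fin n
  ; E  = λ g₁ g₂ g₃ → (g₁ ∙ g₂) ∙ g₃ ≡ ε }
  where open FinGroup G

M : ℕ → ℕ → ℕ → Hypergraph3
M p q r = record
  { V₁ = Fin p × Fin q ; V₂ = Fin q × Fin r ; V₃ = Fin r × Fin p
  ; E  = λ { (i , j) (k , l) (m , n) → j ≡ k × l ≡ m × n ≡ i } }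

data UnionEdge {k : ℕ} (H : Fin k → Hypergraph3)
  : Σ (Fin k) (λ i → V₁ (H i)) → Σ (Fin k) (λ i → V₂ (H i))
  → Σ (Fin k) (λ i → V₃ (H i)) → Set where
  edge : ∀ {i x y z} → E (H i) x y z → UnionEdge H (i , x) (i , y) (i , z)

⨄ : (k : ℕ) → (Fin k → Hypergraph3) → Hypergraph3
⨄ k H = record
  { V₁ = Σ (Fin k) (λ i → V₁ (H i))
  ; V₂ = Σ (Fin k) (λ i → V₂ (H i))
  ; V₃ = Σ (Fin k) (λ i → V₃ (H i))
  ; E  = UnionEdge H }

InducedSub : Hypergraph3 → Hypergraph3 → Set
InducedSub H K =
  Σ[ f₁ ∈ (V₁ H → V₁ K) ] Σ[ f₂ ∈ (V₂ H → V₂ K) ] Σ[ f₃ ∈ (V₃ H → V₃ K) ]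
    ( Injective _≡_ _≡_ f₁ × Injective _≡_ _≡_ f₂ × Injective _≡_ _≡_ f₃
    × (∀ x y z → E H x y z ⇔ E K (f₁ x) (f₂ y) (f₃ z)) )

module _ {n : ℕ} (G : FinGroup n) where
  open FinGroup G

  Triple : Set
  Triple = Fin n × Fin n × Fin n

  AtMostOne : Subset n → Subset n → Subset n → (Triple → Set) → Set
  AtMostOne A B C P =
    ∀ a b c a₁ b₁ c₁ → a ∈ A → b ∈ B → c ∈ C → a₁ ∈ A → b₁ ∈ B → c₁ ∈ C →
    P (a , b , c) → P (a₁ , b₁ , c₁) → (a , b , c) ≡ (a₁ , b₁ , c₁)

  TrapezoidFree : Subset n → Subset n → Subset n → Set
  TrapezoidFree A B C =
    ∀ a' b' c' → a' ∈ A → b' ∈ B → c' ∈ C →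
      AtMostOne A B C (λ { (a , b , c) → ((a' ∙ b) ∙ c ≡ ε) × ((a ∙ b') ∙ c ≡ ε) })
    × AtMostOne A B C (λ { (a , b , c) → ((a' ∙ b) ∙ c ≡ ε) × ((a ∙ b) ∙ c' ≡ ε) })
    × AtMostOne A B C (λ { (a , b , c) → ((a ∙ b') ∙ c ≡ ε) × ((a ∙ b) ∙ c' ≡ ε) })

  indicator : Bool → ℕ
  indicator true  = 1
  indicator false = 0

  solutions : Subset n → Subset n → Subset n → ℕ
  solutions A B C =
    sum (map (λ a → sum (map (λ b → sum (map (λ c →
      indicator (does (a ∈? A)) * indicator (does (b ∈? B)) *
      indicator (does (c ∈? C)) * indicator (does ((a ∙ b) ∙ c ≟ ε)))
      (allFin n))) (allFin n))) (allFin n))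

  -- val(G) ≥ s  (val is the maximum of `solutions` over trapezoid-free triples)
  ValAtLeast : ℕ → Set
  ValAtLeast s = ∃[ A ] ∃[ B ] ∃[ C ] (TrapezoidFree A B C × s ≤ solutions A B C)

ΣFin : (k : ℕ) → (Fin k → ℕ) → ℕ
ΣFin k f = sum (map f (allFin k))

-- In M_{p,q,r} an edge ((i,j),(j,l),(l,i)) is determined by any two of its
-- vertices, so each system in the definition of trapezoid-freeness has at
-- most one solution; the same holds in a vertex-disjoint union, whose edges
-- stay inside one component. Embed such a union in X_G as an induced
-- subhypergraph and let A, B, C be the images of the vertices of its edges:
-- because the embedding reflects edges, trapezoid-freeness passes to
-- (A, B, C), and because it is injective, the n₁m₁p₁ + … + nₖmₖpₖ edges give
-- distinct solutions of abc = 1 in A × B × C.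
module Submission where

open import Defs
open import Data.Nat using (ℕ; _*_)
open import Data.Fin using (Fin)

open import Data.Nat using (suc; _+_; _≤_; z≤n)
open import Data.Nat.Properties using (≤-reflexive; +-mono-≤; *-assoc; module ≤-Reasoning)
open import Data.Nat.ListAction using (sum)
open import Data.Nat.ListAction.Properties using (sum-++; sum-↭)
open import Data.Fin.Properties using (_≟_)
open import Data.Fin.Subset using (Subset; _∈_)
open import Data.Fin.Subset.Properties using (_∈?_)
open import Data.List using (List; []; _∷_; _++_; [_]; map; concat; concatMap; allFin; cartesianProduct; length)
open import Data.List.Properties using (map-++; map-∘; map-cong; length-++; length-map; length-tabulate)
open import Data.List.Membership.Propositional using () renaming (_∈_ to _∈ₗ_)
open import Data.List.Membership.Propositional.Properties
  using (∈-∃++; ∈-allFin; ∈-map⁻; ∈-cartesianProduct⁺)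
open import Data.List.Relation.Unary.Any using (here; there; any?; satisfied) renaming (map to anyMap)
open import Data.List.Relation.Unary.All using (All; _∷_; universal; zipWith; tabulate; lookup) renaming (map to allMap)
import Data.List.Relation.Unary.All.Properties as All
import Data.List.Relation.Unary.AllPairs as AllPairs
import Data.List.Relation.Unary.AllPairs.Properties as AllPairs
open import Data.List.Relation.Unary.Unique.Propositional using (Unique; _∷_)
open import Data.List.Relation.Unary.Unique.Propositional.Properties
  using (map⁺; concat⁺; cartesianProduct⁺; allFin⁺)
open import Data.List.Relation.Binary.Disjoint.Propositional using (Disjoint)
import Data.List.Relation.Binary.Permutation.Propositional.Properties as ↭
import Data.Vec as Vec
open import Data.Vec.Properties using (lookup∘tabulate; lookup⇒[]=; []=⇒lookup)
open import Data.Bool.Properties using (T-≡)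
open import Data.Empty using (⊥-elim)
open import Data.Product using (∃; _×_; _,_; proj₁; proj₂)
open import Relation.Nullary using (does; ¬_)
open import Relation.Nullary.Decidable using (isYes; dec-true; toWitness; fromWitness)
open import Relation.Binary.PropositionalEquality using (_≡_; refl; sym; trans; cong; cong₂; subst; module ≡-Reasoning)
open import Function using (_∘_; _⇔_; Equivalence)
open import Function.Definitions using (Injective)
open Hypergraph3

sum-map-cartesianProduct : {A B : Set} (w : A × B → ℕ) (xs : List A) (ys : List B) →
  sum (map w (cartesianProduct xs ys)) ≡ sum (map (λ x → sum (map (λ y → w (x , y)) ys)) xs)
sum-map-cartesianProduct w []       ys = refl
sum-map-cartesianProduct w (x ∷ xs) ys = begin
  sum (map w (map (x ,_) ys ++ cartesianProduct xs ys))
    ≡⟨ cong sum (map-++ w (map (x ,_) ys) _) ⟩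
  sum (map w (map (x ,_) ys) ++ map w (cartesianProduct xs ys))
    ≡⟨ sum-++ (map w (map (x ,_) ys)) _ ⟩
  sum (map w (map (x ,_) ys)) + sum (map w (cartesianProduct xs ys))
    ≡⟨ cong₂ _+_ (cong sum (sym (map-∘ ys))) (sum-map-cartesianProduct w xs ys) ⟩
  sum (map (λ y → w (x , y)) ys) + sum (map (λ x → sum (map (λ y → w (x , y)) ys)) xs) ∎
  where open ≡-Reasoning

length-cartesianProduct : {A B : Set} (xs : List A) (ys : List B) →
  length (cartesianProduct xs ys) ≡ length xs * length ys
length-cartesianProduct []       ys = refl
length-cartesianProduct (x ∷ xs) ys = trans (length-++ (map (x ,_) ys))
  (cong₂ _+_ (length-map (x ,_) ys) (length-cartesianProduct xs ys))

length-allFin : (n : ℕ) → length (allFin n) ≡ n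
length-allFin n = length-tabulate {n = n} (λ i → i)

length-concat : {A : Set} (xss : List (List A)) → length (concat xss) ≡ sum (map length xss)
length-concat []         = refl
length-concat (xs ∷ xss) = trans (length-++ xs) (cong (length xs +_) (length-concat xss))

sum-map-shift : {A : Set} (w : A → ℕ) {x : A} (ys zs : List A) →
  sum (map w (ys ++ [ x ] ++ zs)) ≡ w x + sum (map w (ys ++ zs))
sum-map-shift w {x} ys zs = sum-↭ (↭.map⁺ w (↭.shift x ys zs))

∈-remove : {A : Set} {x y : A} (ys zs : List A) →
  y ∈ₗ ys ++ [ x ] ++ zs → ¬ x ≡ y → y ∈ₗ ys ++ zs
∈-remove []       zs (here refl) x≢y = ⊥-elim (x≢y refl)
∈-remove []       zs (there y∈)  x≢y = y∈
∈-remove (_ ∷ ys) zs (here refl) x≢y = here refl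
∈-remove (_ ∷ ys) zs (there y∈)  x≢y = there (∈-remove ys zs y∈ x≢y)

length≤sum-map : {A : Set} (w : A → ℕ) (L S : List A) → Unique S →
  All (_∈ₗ L) S → All (λ x → 1 ≤ w x) S → length S ≤ sum (map w L)
length≤sum-map w L []      _           _          _          = z≤n
length≤sum-map w L (x ∷ S) (x∉S ∷ S!) (x∈L ∷ S⊆L) (1≤wx ∷ ws) with ∈-∃++ x∈L
... | ys , zs , refl = begin
  suc (length S)                 ≤⟨ +-mono-≤ 1≤wx (length≤sum-map w (ys ++ zs) S S! S⊆L′ ws) ⟩
  w x + sum (map w (ys ++ zs))   ≡⟨ sym (sum-map-shift w ys zs) ⟩
  sum (map w (ys ++ [ x ] ++ zs)) ∎
  where
  open ≤-Reasoning
  S⊆L′ : All (_∈ₗ ys ++ zs) S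
  S⊆L′ = zipWith (λ (y∈ , x≢y) → ∈-remove ys zs y∈ x≢y) (S⊆L , x∉S)

image : {n : ℕ} {D : Set} → List D → (D → Fin n) → Subset n
image ds f = Vec.tabulate (λ g → isYes (any? (λ d → f d ≟ g) ds))

∈-image⁺ : {n : ℕ} {D : Set} {ds : List D} (f : D → Fin n) {d : D} →
  d ∈ₗ ds → f d ∈ image ds f
∈-image⁺ {ds = ds} f {d} d∈ds = lookup⇒[]= (f d) (image ds f)
  (trans (lookup∘tabulate _ (f d)) (Equivalence.to T-≡ (fromWitness (anyMap (cong f ∘ sym) d∈ds))))

∈-image⁻ : {n : ℕ} {D : Set} {ds : List D} {f : D → Fin n} {g : Fin n} →
  g ∈ image ds f → ∃ λ d → f d ≡ g
∈-image⁻ {ds = ds} {f} {g} g∈ = satisfied (toWitness {a? = any? (λ d → f d ≟ g) ds}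
  (Equivalence.from T-≡ (trans (sym (lookup∘tabulate _ g)) ([]=⇒lookup g∈))))

module _ {n : ℕ} (G : FinGroup n) where
  open FinGroup G

  solutionIndicator : Subset n → Subset n → Subset n → Triple G → ℕ
  solutionIndicator A B C (a , b , c) =
    indicator G (does (a ∈? A)) * indicator G (does (b ∈? B)) *
    indicator G (does (c ∈? C)) * indicator G (does ((a ∙ b) ∙ c ≟ ε))

  allTriples : List (Triple G)
  allTriples = cartesianProduct (allFin n) (cartesianProduct (allFin n) (allFin n))

  ∈-allTriples : (t : Triple G) → t ∈ₗ allTriples
  ∈-allTriples (a , b , c) = ∈-cartesianProduct⁺ (∈-allFin a) (∈-cartesianProduct⁺ (∈-allFin b) (∈-allFin c))

  solutions≡sum-solutionIndicator : (A B C : Subset n) →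
    solutions G A B C ≡ sum (map (solutionIndicator A B C) allTriples)
  solutions≡sum-solutionIndicator A B C = begin
    solutions G A B C
      ≡⟨ cong sum (map-cong (λ a → sum-map-cartesianProduct _ (allFin n) (allFin n)) (allFin n)) ⟨
    sum (map (λ a → sum (map (λ bc → solutionIndicator A B C (a , bc)) allPairs)) (allFin n))
      ≡⟨ sum-map-cartesianProduct _ (allFin n) allPairs ⟨
    sum (map (solutionIndicator A B C) allTriples) ∎
    where
    open ≡-Reasoning
    allPairs : List (Fin n × Fin n)
    allPairs = cartesianProduct (allFin n) (allFin n)

  solutionIndicator≡1 : {A B C : Subset n} {a b c : Fin n} → a ∈ A → b ∈ B → c ∈ C →
    (a ∙ b) ∙ c ≡ ε → solutionIndicator A B C (a , b , c) ≡ 1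
  solutionIndicator≡1 {A} {B} {C} {a} {b} {c} a∈A b∈B c∈C abc≡ε
    rewrite dec-true (a ∈? A) a∈A | dec-true (b ∈? B) b∈B | dec-true (c ∈? C) c∈C
          | dec-true ((a ∙ b) ∙ c ≟ ε) abc≡ε = refl

VertexTriple : Hypergraph3 → Set
VertexTriple H = V₁ H × V₂ H × V₃ H

IsEdge : (H : Hypergraph3) → VertexTriple H → Set
IsEdge H (x , y , z) = E H x y z

HasAtMostOne : {T : Set} → (T → Set) → Set
HasAtMostOne P = ∀ {t t₁} → P t → P t₁ → t ≡ t₁

record IsTrapezoidFree (H : Hypergraph3) : Set where
  field
    determined₁₂ : ∀ x′ y′ → HasAtMostOne {VertexTriple H} λ { (x , y , z) → E H x′ y z × E H x y′ z }
    determined₁₃ : ∀ x′ z′ → HasAtMostOne {VertexTriple H} λ { (x , y , z) → E H x′ y z × E H x y z′ }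
    determined₂₃ : ∀ y′ z′ → HasAtMostOne {VertexTriple H} λ { (x , y , z) → E H x y′ z × E H x y z′ }
open IsTrapezoidFree

M-trapezoidFree : (p q r : ℕ) → IsTrapezoidFree (M p q r)
determined₁₂ (M-trapezoidFree p q r) _ _
  ((refl , refl , refl) , (refl , refl , refl)) ((refl , refl , refl) , (refl , refl , refl)) = refl
determined₁₃ (M-trapezoidFree p q r) _ _
  ((refl , refl , refl) , (refl , refl , refl)) ((refl , refl , refl) , (refl , refl , refl)) = refl
determined₂₃ (M-trapezoidFree p q r) _ _
  ((refl , refl , refl) , (refl , refl , refl)) ((refl , refl , refl) , (refl , refl , refl)) = refl

⨄-trapezoidFree : {k : ℕ} {H : Fin k → Hypergraph3} →
  (∀ i → IsTrapezoidFree (H i)) → IsTrapezoidFree (⨄ k H)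
determined₁₂ (⨄-trapezoidFree tf) (i , x′) (_ , y′) (edge e₁ , edge e₂) (edge e₃ , edge e₄)
  with refl ← determined₁₂ (tf i) x′ y′ (e₁ , e₂) (e₃ , e₄) = refl
determined₁₃ (⨄-trapezoidFree tf) (i , x′) (_ , z′) (edge e₁ , edge e₂) (edge e₃ , edge e₄)
  with refl ← determined₁₃ (tf i) x′ z′ (e₁ , e₂) (e₃ , e₄) = refl
determined₂₃ (⨄-trapezoidFree tf) (i , y′) (_ , z′) (edge e₁ , edge e₂) (edge e₃ , edge e₄)
  with refl ← determined₂₃ (tf i) y′ z′ (e₁ , e₂) (e₃ , e₄) = refl

module EdgeImages {n : ℕ} (G : FinGroup n) {H : Hypergraph3}
  (f₁ : V₁ H → Fin n) (f₂ : V₂ H → Fin n) (f₃ : V₃ H → Fin n)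
  (induced : ∀ x y z → E H x y z ⇔ E (X G) (f₁ x) (f₂ y) (f₃ z))
  (es : List (VertexTriple H)) where

  embed : VertexTriple H → Triple G
  embed (x , y , z) = f₁ x , f₂ y , f₃ z

  edge← : ∀ x y z → E (X G) (f₁ x) (f₂ y) (f₃ z) → E H x y z
  edge← x y z = Equivalence.from (induced x y z)

  image₁ image₂ image₃ : Subset n
  image₁ = image es (f₁ ∘ proj₁)
  image₂ = image es (f₂ ∘ proj₁ ∘ proj₂)
  image₃ = image es (f₃ ∘ proj₂ ∘ proj₂)

  atMostOne-image : {P : Triple G → Set} {Q : VertexTriple H → Set} →
    HasAtMostOne Q → (∀ t → P (embed t) → Q t) → AtMostOne G image₁ image₂ image₃ P
  atMostOne-image Q! reflect _ _ _ _ _ _ a∈ b∈ c∈ a₁∈ b₁∈ c₁∈ p p₁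
    with ∈-image⁻ a∈  | ∈-image⁻ b∈  | ∈-image⁻ c∈
       | ∈-image⁻ a₁∈ | ∈-image⁻ b₁∈ | ∈-image⁻ c₁∈
  ... | (x  , _) , refl | (_ , y  , _) , refl | (_ , _ , z)  , refl
      | (x₁ , _) , refl | (_ , y₁ , _) , refl | (_ , _ , z₁) , refl =
    cong embed (Q! (reflect (x , y , z) p) (reflect (x₁ , y₁ , z₁) p₁))

  image-trapezoidFree : IsTrapezoidFree H → TrapezoidFree G image₁ image₂ image₃
  image-trapezoidFree tf _ _ _ a′∈ b′∈ c′∈
    with ∈-image⁻ a′∈ | ∈-image⁻ b′∈ | ∈-image⁻ c′∈
  ... | (x′ , _) , refl | (_ , y′ , _) , refl | (_ , _ , z′) , refl =
      atMostOne-image (determined₁₂ tf x′ y′) (λ (x , y , z) (p , q) → edge← x′ y z p , edge← x y′ z q)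
    , atMostOne-image (determined₁₃ tf x′ z′) (λ (x , y , z) (p , q) → edge← x′ y z p , edge← x y z′ q)
    , atMostOne-image (determined₂₃ tf y′ z′) (λ (x , y , z) (p , q) → edge← x y′ z p , edge← x y z′ q)

  module _ (inj₁ : Injective _≡_ _≡_ f₁) (inj₂ : Injective _≡_ _≡_ f₂) (inj₃ : Injective _≡_ _≡_ f₃) where

    embed-injective : Injective _≡_ _≡_ embed
    embed-injective eq = cong₂ _,_ (inj₁ (cong proj₁ eq))
      (cong₂ _,_ (inj₂ (cong (proj₁ ∘ proj₂) eq)) (inj₃ (cong (proj₂ ∘ proj₂) eq)))

    length≤solutions : Unique es → All (IsEdge H) es → length es ≤ solutions G image₁ image₂ image₃
    length≤solutions es! edges = begin
      length es
        ≡⟨ length-map embed es ⟨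
      length (map embed es)
        ≤⟨ length≤sum-map counts (allTriples G) (map embed es) (map⁺ embed-injective es!)
             (universal (∈-allTriples G) _) (All.map⁺ (tabulate counted)) ⟩
      sum (map counts (allTriples G))
        ≡⟨ solutions≡sum-solutionIndicator G image₁ image₂ image₃ ⟨
      solutions G image₁ image₂ image₃ ∎
      where
      open ≤-Reasoning
      counts : Triple G → ℕ
      counts = solutionIndicator G image₁ image₂ image₃
      counted : ∀ {t} → t ∈ₗ es → 1 ≤ counts (embed t)
      counted {x , y , z} t∈ = ≤-reflexive (sym (solutionIndicator≡1 G
        (∈-image⁺ (f₁ ∘ proj₁) t∈) (∈-image⁺ (f₂ ∘ proj₁ ∘ proj₂) t∈) (∈-image⁺ (f₃ ∘ proj₂ ∘ proj₂) t∈)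
        (Equivalence.to (induced x y z) (lookup edges t∈))))

valAtLeast-edgeList : {n : ℕ} (G : FinGroup n) {H : Hypergraph3} → IsTrapezoidFree H →
  InducedSub H (X G) → (es : List (VertexTriple H)) → Unique es → All (IsEdge H) es →
  ValAtLeast G (length es)
valAtLeast-edgeList G tf (f₁ , f₂ , f₃ , inj₁ , inj₂ , inj₃ , induced) es es! edges =
  image₁ , image₂ , image₃ , image-trapezoidFree tf , length≤solutions inj₁ inj₂ inj₃ es! edges
  where open EdgeImages G f₁ f₂ f₃ induced es

triangleEdge : {p q r : ℕ} → Fin p × Fin q × Fin r → VertexTriple (M p q r)
triangleEdge (i , j , l) = (i , j) , (j , l) , (l , i)

M-edgeList : (p q r : ℕ) → List (VertexTriple (M p q r))
M-edgeList p q r = map triangleEdge (cartesianProduct (allFin p) (cartesianProduct (allFin q) (allFin r)))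

M-edgeList-unique : (p q r : ℕ) → Unique (M-edgeList p q r)
M-edgeList-unique p q r = map⁺ triangleEdge-injective
  (cartesianProduct⁺ (allFin⁺ p) (cartesianProduct⁺ (allFin⁺ q) (allFin⁺ r)))
  where
  triangleEdge-injective : Injective _≡_ _≡_ (triangleEdge {p} {q} {r})
  triangleEdge-injective refl = refl

M-edgeList-edges : (p q r : ℕ) → All (IsEdge (M p q r)) (M-edgeList p q r)
M-edgeList-edges p q r = All.map⁺ (universal (λ _ → refl , refl , refl) _)

length-M-edgeList : (p q r : ℕ) → length (M-edgeList p q r) ≡ p * q * r
length-M-edgeList p q r = begin
  length (M-edgeList p q r)
    ≡⟨ length-map triangleEdge (cartesianProduct (allFin p) _) ⟩
  length (cartesianProduct (allFin p) (cartesianProduct (allFin q) (allFin r)))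
    ≡⟨ length-cartesianProduct (allFin p) _ ⟩
  length (allFin p) * length (cartesianProduct (allFin q) (allFin r))
    ≡⟨ cong₂ _*_ (length-allFin p) (trans (length-cartesianProduct (allFin q) (allFin r))
                                        (cong₂ _*_ (length-allFin q) (length-allFin r))) ⟩
  p * (q * r)
    ≡⟨ sym (*-assoc p q r) ⟩
  p * q * r ∎
  where open ≡-Reasoning

module _ {k : ℕ} (H : Fin k → Hypergraph3) where

  inject : (i : Fin k) → VertexTriple (H i) → VertexTriple (⨄ k H)
  inject i (x , y , z) = (i , x) , (i , y) , (i , z)

  ⨄-edgeList : (∀ i → List (VertexTriple (H i))) → List (VertexTriple (⨄ k H))
  ⨄-edgeList ls = concatMap (λ i → map (inject i) (ls i)) (allFin k)

  ⨄-edgeList-unique : (ls : ∀ i → List (VertexTriple (H i))) → (∀ i → Unique (ls i)) →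
    Unique (⨄-edgeList ls)
  ⨄-edgeList-unique ls ls! = concat⁺
    (All.map⁺ (universal (λ i → map⁺ inject-injective (ls! i)) (allFin k)))
    (AllPairs.map⁺ (AllPairs.map disjoint (allFin⁺ k)))
    where
    inject-injective : ∀ {i} → Injective _≡_ _≡_ (inject i)
    inject-injective refl = refl
    disjoint : ∀ {i j} → ¬ i ≡ j → Disjoint (map (inject i) (ls i)) (map (inject j) (ls j))
    disjoint i≢j (e∈ᵢ , e∈ⱼ) with ∈-map⁻ (inject _) e∈ᵢ | ∈-map⁻ (inject _) e∈ⱼ
    ... | _ , _ , refl | _ , _ , eq = i≢j (cong (proj₁ ∘ proj₁) eq)

  ⨄-edgeList-edges : (ls : ∀ i → List (VertexTriple (H i))) → (∀ i → All (IsEdge (H i)) (ls i)) →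
    All (IsEdge (⨄ k H)) (⨄-edgeList ls)
  ⨄-edgeList-edges ls edges = All.concat⁺
    (All.map⁺ (universal (λ i → All.map⁺ (allMap edge (edges i))) (allFin k)))

  length-⨄-edgeList : (ls : ∀ i → List (VertexTriple (H i))) →
    length (⨄-edgeList ls) ≡ ΣFin k (length ∘ ls)
  length-⨄-edgeList ls = begin
    length (⨄-edgeList ls)
      ≡⟨ length-concat (map injected (allFin k)) ⟩
    sum (map length (map injected (allFin k)))
      ≡⟨ cong sum (map-∘ (allFin k)) ⟨
    sum (map (length ∘ injected) (allFin k))
      ≡⟨ cong sum (map-cong (λ i → length-map (inject i) (ls i)) (allFin k)) ⟩
    ΣFin k (length ∘ ls) ∎
    where
    open ≡-Reasoning
    injected : ∀ i → List (VertexTriple (⨄ k H))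
    injected i = map (inject i) (ls i)

proposition3p3 : (n : ℕ) (G : FinGroup n) (k : ℕ) (ns ms ps : Fin k → ℕ) →
    InducedSub (⨄ k (λ i → M (ns i) (ms i) (ps i))) (X G) →
    ValAtLeast G (ΣFin k (λ i → ns i * ms i * ps i))
proposition3p3 n G k ns ms ps emb = subst (ValAtLeast G) edgeCount
  (valAtLeast-edgeList G (⨄-trapezoidFree λ i → M-trapezoidFree (ns i) (ms i) (ps i)) emb
    (⨄-edgeList Ms edgesᵢ)
    (⨄-edgeList-unique Ms edgesᵢ λ i → M-edgeList-unique (ns i) (ms i) (ps i))
    (⨄-edgeList-edges Ms edgesᵢ λ i → M-edgeList-edges (ns i) (ms i) (ps i)))
  where
  Ms : Fin k → Hypergraph3
  Ms i = M (ns i) (ms i) (ps i)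
  edgesᵢ : ∀ i → List (VertexTriple (Ms i))
  edgesᵢ i = M-edgeList (ns i) (ms i) (ps i)
  edgeCount : length (⨄-edgeList Ms edgesᵢ) ≡ ΣFin k (λ i → ns i * ms i * ps i)
  edgeCount = trans (length-⨄-edgeList Ms edgesᵢ)
    (cong sum (map-cong (λ i → length-M-edgeList (ns i) (ms i) (ps i)) (allFin k)))
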